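{- Let $A(p,p,0)=\sum_D p^{\mathrm{sump}(D)+\mathrm{nbp}(D)}$, the sum over all non-empty Dyck paths $D$ all of whose valleys are at height $0$. Equivalently, $A(p,p,0)=\sum_P p^{\mathrm{area}(P)}$ over Stanley polyominoes $P$ with at least two columns and no interior points. Then \[ A(p,p,0)=\frac{p^2}{1-p-p^2}, \] and $[p^n]A(p,p,0)=F_{n-1}$ for $n\geq2$, where $F_0=0$, $F_1=1$, $F_n=F_{n-1}+F_{n-2}$.
   Context: Dyck paths are lattice paths from $(0,0)$ to $(2n,0)$ with steps $u=(1,1)$, $d=(1,-1)$ never going below the $x$-axis. A peak (resp. valley) is an occurrence of $ud$ (resp. $du$), its height being the ordinate of the common point of the two steps; $\mathrm{nbp}(D)$ is the number of peaks and $\mathrm{sump}(D)$ the sum of peak heights. A Stanley polyomino (up to translation) is a set of unit cells $[i,i+1]\times[j,j+1]$ forming rows $0,\dots,k-1$, row $j$ consisting of cells with $s_j\le i\le e_j$, such that $s_{j-1}<s_j\le e_{j-1}<e_j$; its number of columns is $e_{k-1}-s_0+1$, its area is its number of cells, and an interior point is a lattice point belonging to exactly four of its cells. -}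

module Defs where

open import Data.Bool using (Bool; true; false; _∧_; not)
open import Data.Nat using (ℕ; zero; suc; _+_; _*_; _∸_; _≡ᵇ_; pred)
open import Data.List using (List; []; _∷_; map; filter; length; concatMap; upTo; null)
open import Data.Nat.ListAction using (sum)
open import Data.Integer using (ℤ; +_) renaming (_+_ to _+ℤ_; _*_ to _*ℤ_; -_ to -ℤ_)
open import Relation.Nullary.Decidable using (Dec; yes; no)
open import Relation.Binary.PropositionalEquality using (_≡_; refl)

-- Steps of a lattice path: U = (1,1), D = (1,-1).
data Step : Set where
  U D : Step

isDyckFrom : ℕ → List Step → Bool
isDyckFrom zero    []      = true
isDyckFrom (suc _) []      = false
isDyckFrom h       (U ∷ w) = isDyckFrom (suc h) w
isDyckFrom zero    (D ∷ w) = false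
isDyckFrom (suc h) (D ∷ w) = isDyckFrom h w

isDyck : List Step → Bool
isDyck = isDyckFrom 0

-- Heights of the peaks (occurrences of U D), the height being the ordinate
-- of the common point of the two steps; h is the current height.
peakHeightsFrom : ℕ → List Step → List ℕ
peakHeightsFrom h []           = []
peakHeightsFrom h (U ∷ D ∷ w)  = suc h ∷ peakHeightsFrom (suc h) (D ∷ w)
peakHeightsFrom h (U ∷ w)      = peakHeightsFrom (suc h) w
peakHeightsFrom h (D ∷ w)      = peakHeightsFrom (pred h) w

valleyHeightsFrom : ℕ → List Step → List ℕ
valleyHeightsFrom h []           = []
valleyHeightsFrom h (D ∷ U ∷ w)  = pred h ∷ valleyHeightsFrom (pred h) (U ∷ w)
valleyHeightsFrom h (D ∷ w)      = valleyHeightsFrom (pred h) w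
valleyHeightsFrom h (U ∷ w)      = valleyHeightsFrom (suc h) w

nbp : List Step → ℕ
nbp w = length (peakHeightsFrom 0 w)

sump : List Step → ℕ
sump w = sum (peakHeightsFrom 0 w)

allZero : List ℕ → Bool
allZero []       = true
allZero (x ∷ xs) = (x ≡ᵇ 0) ∧ allZero xs

valleysAtZero : List Step → Bool
valleysAtZero w = allZero (valleyHeightsFrom 0 w)

words : ℕ → List (List Step)
words zero    = [] ∷ []
words (suc k) = concatMap (λ w → (U ∷ w) ∷ (D ∷ w) ∷ []) (words k)

contributes : ℕ → List Step → Bool
contributes n w = isDyck w ∧ not (null w) ∧ valleysAtZero w ∧ ((sump w + nbp w) ≡ᵇ n)

count : ℕ → ℕ → ℕ
count n m = length (filter (λ w → contributes n w Data.Bool.≟ true) (words (2 * m)))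
  where import Data.Bool

-- [p^n] A(p,p,0), summing over semilengths 0..n (the first conjunct of
-- corollary3p3 states that larger semilengths contribute nothing).
coeffA : ℕ → ℕ
coeffA n = sum (map (count n) (upTo (suc n)))

fib : ℕ → ℕ
fib zero          = 0
fib (suc zero)    = 1
fib (suc (suc n)) = fib (suc n) + fib n

denom : ℕ → ℤ
denom 0 = + 1
denom 1 = -ℤ (+ 1)
denom 2 = -ℤ (+ 1)
denom _ = + 0

numer : ℕ → ℤ
numer 2 = + 1
numer _ = + 0

sumℤ : List ℤ → ℤ
sumℤ []       = + 0
sumℤ (x ∷ xs) = x +ℤ sumℤ xs

conv : (ℕ → ℤ) → (ℕ → ℤ) → ℕ → ℤ
conv f g n = sumℤ (map (λ i → f i *ℤ g (n ∸ i)) (upTo (suc n)))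

{-# OPTIONS --safe #-}
-- A Dyck path all of whose valleys lie on the axis is a sequence of pyramids U^k D^k
-- (k ≥ 1), and a pyramid of height k adds k + 1 to sump + nbp.  Counting such words letter
-- by letter, the completions of a pyramid being climbed at height k + 1 are equinumerous
-- with those at height k and weight one less.  Splitting on whether the first pyramid has
-- height 1 therefore gives count (n+2) (m+2) = count (n+1) (m+1) + count n (m+1).  Hence
-- count n m vanishes for n < m, and summing over m gives [p^(n+2)] A = [n = 0] +
-- [p^(n+1)] A + [p^n] A: Fibonacci numbers, which 1 - p - p^2 turns into p^2.
module Submission where

open import Defs
open import Data.Nat using (ℕ; _<_; _≤_; _∸_)
open import Data.Integer using (+_)
open import Data.Product using (_×_)
open import Relation.Binary.PropositionalEquality using (_≡_)

open import Data.Bool using (Bool; true; false; _∧_; _≟_)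
open import Data.Bool.Properties using (∧-zeroʳ)
open import Data.Integer using (ℤ; _-_; -1ℤ) renaming (_+_ to _+ℤ_; _*_ to _*ℤ_)
import Data.Integer.Properties as ℤ
open import Data.Integer.Tactic.RingSolver using (solve-∀)
open import Data.List using (List; []; _∷_; _∷ʳ_; length; filter; map; concatMap; applyUpTo)
open import Data.List.Properties using (applyUpTo-∷ʳ; map-applyUpTo)
open import Data.Nat using (zero; suc; _+_; _*_; _≡ᵇ_; s≤s; z≤n)
open import Data.Nat.ListAction using (sum)
open import Data.Nat.ListAction.Properties using (sum-++)
open import Data.Nat.Properties
  using (+-suc; +-assoc; +-identityʳ; *-suc; +-commutativeSemigroup; m<n⇒m<1+n; n<1+n)
open import Data.Product using (_,_)
open import Function using (_∘_)
open import Algebra.Properties.CommutativeSemigroup +-commutativeSemigroup using (interchange)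
open import Relation.Binary.PropositionalEquality
  using (refl; sym; trans; cong; cong₂; _≗_; module ≡-Reasoning)

#[_] : {A : Set} → (A → Bool) → List A → ℕ
#[ P ] xs = length (filter (λ x → P x ≟ true) xs)

module _ {A : Set} where

  #-cong : {P Q : A → Bool} → P ≗ Q → #[ P ] ≗ #[ Q ]
  #-cong e [] = refl
  #-cong {P} {Q} e (x ∷ xs) with P x | Q x | e x
  ... | true  | .true  | refl = cong suc (#-cong e xs)
  ... | false | .false | refl = #-cong e xs

  #-none : {P : A → Bool} → (∀ x → P x ≡ false) → ∀ xs → #[ P ] xs ≡ 0
  #-none none [] = refl
  #-none {P} none (x ∷ xs) with P x | none x
  ... | false | refl = #-none none xs

  #-concatMap-pair : {B : Set} (P : B → Bool) (f g : A → B) (xs : List A) →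
    #[ P ] (concatMap (λ x → f x ∷ g x ∷ []) xs) ≡ #[ P ∘ f ] xs + #[ P ∘ g ] xs
  #-concatMap-pair P f g [] = refl
  #-concatMap-pair P f g (x ∷ xs) with P (f x)
  #-concatMap-pair P f g (x ∷ xs) | true with P (g x)
  ... | true  = cong suc (trans (cong suc (#-concatMap-pair P f g xs)) (sym (+-suc _ _)))
  ... | false = cong suc (#-concatMap-pair P f g xs)
  #-concatMap-pair P f g (x ∷ xs) | false with P (g x)
  ... | true  = trans (cong suc (#-concatMap-pair P f g xs)) (sym (+-suc _ _))
  ... | false = #-concatMap-pair P f g xs

sum-applyUpTo-+ : ∀ {h} (f g : ℕ → ℕ) → (∀ i → h i ≡ f i + g i) →
  ∀ k → sum (applyUpTo h k) ≡ sum (applyUpTo f k) + sum (applyUpTo g k)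
sum-applyUpTo-+ f g e zero    = refl
sum-applyUpTo-+ f g e (suc k) =
  trans (cong₂ _+_ (e 0) (sum-applyUpTo-+ (f ∘ suc) (g ∘ suc) (e ∘ suc) k))
        (interchange (f 0) (g 0) (sum (applyUpTo (f ∘ suc) k)) (sum (applyUpTo (g ∘ suc) k)))

sum-applyUpTo-suc : ∀ (f : ℕ → ℕ) k → sum (applyUpTo f (suc k)) ≡ sum (applyUpTo f k) + f k
sum-applyUpTo-suc f k = begin
  sum (applyUpTo f (suc k))        ≡⟨ cong sum (applyUpTo-∷ʳ f k) ⟨
  sum (applyUpTo f k ∷ʳ f k)       ≡⟨ sum-++ (applyUpTo f k) (f k ∷ []) ⟩
  sum (applyUpTo f k) + (f k + 0)  ≡⟨ cong (λ x → sum (applyUpTo f k) + x) (+-identityʳ (f k)) ⟩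
  sum (applyUpTo f k) + f k        ∎
  where open ≡-Reasoning

sumℤ-applyUpTo-zero : ∀ {f : ℕ → ℤ} → (∀ i → f i ≡ + 0) →
  ∀ k → sumℤ (applyUpTo f k) ≡ + 0
sumℤ-applyUpTo-zero e zero    = refl
sumℤ-applyUpTo-zero e (suc k) = cong₂ _+ℤ_ (e 0) (sumℤ-applyUpTo-zero (e ∘ suc) k)

n<m⇒m+x≡ᵇn≡false : ∀ {m n} x → n < m → (m + x ≡ᵇ n) ≡ false
n<m⇒m+x≡ᵇn≡false {suc m} {zero}  x _          = refl
n<m⇒m+x≡ᵇn≡false {suc m} {suc n} x (s≤s n<m) = n<m⇒m+x≡ᵇn≡false x n<m

#words-suc-U : (P : List Step → Bool) → (∀ w → P (D ∷ w) ≡ false) →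
  ∀ L → #[ P ] (words (suc L)) ≡ #[ P ∘ (U ∷_) ] (words L)
#words-suc-U P noD L = begin
  #[ P ] (words (suc L))
    ≡⟨ #-concatMap-pair P (U ∷_) (D ∷_) (words L) ⟩
  #[ P ∘ (U ∷_) ] (words L) + #[ P ∘ (D ∷_) ] (words L)
    ≡⟨ cong (λ k → #[ P ∘ (U ∷_) ] (words L) + k) (#-none noD (words L)) ⟩
  #[ P ∘ (U ∷_) ] (words L) + 0
    ≡⟨ +-identityʳ _ ⟩
  #[ P ∘ (U ∷_) ] (words L)
    ∎
  where open ≡-Reasoning

peakWeight : List ℕ → ℕ
peakWeight hs = sum (map suc hs)

sum+length≡peakWeight : ∀ hs → sum hs + length hs ≡ peakWeight hs
sum+length≡peakWeight []       = refl
sum+length≡peakWeight (h ∷ hs) =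
  trans (+-suc (h + sum hs) (length hs))
        (cong suc (trans (+-assoc h (sum hs) (length hs))
                         (cong (λ k → h + k) (sum+length≡peakWeight hs))))

-- contributes n, for a suffix w read from height h and without the non-emptiness condition
admissible : ℕ → ℕ → List Step → Bool
admissible h n w =
  isDyckFrom h w ∧ allZero (valleyHeightsFrom h w) ∧ (peakWeight (peakHeightsFrom h w) ≡ᵇ n)

contributes-U : ∀ n w → contributes n (U ∷ w) ≡ admissible 0 n (U ∷ w)
contributes-U n w =
  cong (λ k → isDyckFrom 1 w ∧ allZero (valleyHeightsFrom 1 w) ∧ (k ≡ᵇ n))
       (sum+length≡peakWeight (peakHeightsFrom 0 (U ∷ w)))

admissible-UU : ∀ h n w → admissible h n (U ∷ U ∷ w) ≡ admissible (suc h) n (U ∷ w)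
admissible-UU zero    n w = refl
admissible-UU (suc h) n w = refl

admissible-UDD : ∀ h n w →
  admissible (suc h) (suc n) (U ∷ D ∷ D ∷ w) ≡ admissible h n (U ∷ D ∷ w)
admissible-UDD zero    n w = refl
admissible-UDD (suc h) n w = refl

admissible-UDU : ∀ h n w → admissible (suc h) n (U ∷ D ∷ U ∷ w) ≡ false
admissible-UDU h n w = ∧-zeroʳ (isDyckFrom (suc h) (U ∷ D ∷ U ∷ w))

admissible-UD-light : ∀ {h n} w → n < 2 + h → admissible h n (U ∷ D ∷ w) ≡ false
admissible-UD-light {h} {n} w n<2+h
  rewrite n<m⇒m+x≡ᵇn≡false (peakWeight (peakHeightsFrom (suc h) (D ∷ w))) n<2+h
  = trans (cong (isDyckFrom h (U ∷ D ∷ w) ∧_) (∧-zeroʳ _)) (∧-zeroʳ _)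

admissible-UD-ground : ∀ n w → admissible 0 (2 + n) (U ∷ D ∷ w) ≡ admissible 0 n w
admissible-UD-ground n []      = refl
admissible-UD-ground n (U ∷ w) = refl
admissible-UD-ground n (D ∷ w) = refl

afterUp afterPeak : ℕ → ℕ → ℕ → ℕ
afterUp   h n L = #[ (λ w → admissible h n (U ∷ w)) ] (words L)
afterPeak h n L = #[ (λ w → admissible h n (U ∷ D ∷ w)) ] (words L)

afterUp-zero : ∀ h n → afterUp h n 0 ≡ 0
afterUp-zero zero    n = refl
afterUp-zero (suc h) n = refl

afterUp-suc : ∀ h n L → afterUp h n (suc L) ≡ afterUp (suc h) n L + afterPeak h n L
afterUp-suc h n L =
  trans (#-concatMap-pair (λ w → admissible h n (U ∷ w)) (U ∷_) (D ∷_) (words L))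
        (cong (_+ afterPeak h n L) (#-cong (admissible-UU h n) (words L)))

afterPeak-light : ∀ {h n} L → n < 2 + h → afterPeak h n L ≡ 0
afterPeak-light L n<2+h = #-none (λ w → admissible-UD-light w n<2+h) (words L)

afterUp-light : ∀ {h n} L → n < 2 + h → afterUp h n L ≡ 0
afterUp-light {h} {n} zero    _     = afterUp-zero h n
afterUp-light {h} {n} (suc L) n<2+h = begin
  afterUp h n (suc L)
    ≡⟨ afterUp-suc h n L ⟩
  afterUp (suc h) n L + afterPeak h n L
    ≡⟨ cong (_+ afterPeak h n L) (afterUp-light L (m<n⇒m<1+n n<2+h)) ⟩
  afterPeak h n L
    ≡⟨ afterPeak-light L n<2+h ⟩
  0
    ∎
  where open ≡-Reasoning

afterPeak-shrink : ∀ h n L → afterPeak (suc h) (suc n) (suc L) ≡ afterPeak h n L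
afterPeak-shrink h n L =
  trans (#-concatMap-pair (λ w → admissible (suc h) (suc n) (U ∷ D ∷ w)) (U ∷_) (D ∷_) (words L))
        (cong₂ _+_ (#-none (admissible-UDU h (suc n)) (words L))
                   (#-cong (admissible-UDD h n) (words L)))

afterUp-shrink : ∀ h n L → afterUp (suc h) (suc n) (suc L) ≡ afterUp h n L
afterUp-shrink h n zero    = sym (afterUp-zero h n)
afterUp-shrink h n (suc L) = begin
  afterUp (suc h) (suc n) (suc (suc L))
    ≡⟨ afterUp-suc (suc h) (suc n) (suc L) ⟩
  afterUp (2 + h) (suc n) (suc L) + afterPeak (suc h) (suc n) (suc L)
    ≡⟨ cong₂ _+_ (afterUp-shrink (suc h) n L) (afterPeak-shrink h n L) ⟩
  afterUp (suc h) n L + afterPeak h n L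
    ≡⟨ afterUp-suc h n L ⟨
  afterUp h n (suc L)
    ∎
  where open ≡-Reasoning

afterPeak-ground : ∀ n L → afterPeak 0 (2 + n) (suc L) ≡ afterUp 0 n L
afterPeak-ground n L = trans (#-cong (admissible-UD-ground n) (words (suc L)))
                             (#words-suc-U (admissible 0 n) (λ _ → refl) L)

count-suc : ∀ n m → count n (suc m) ≡ afterUp 0 n (1 + 2 * m)
count-suc n m = begin
  count n (suc m)
    ≡⟨ cong (#[ contributes n ] ∘ words) (*-suc 2 m) ⟩
  #[ contributes n ] (words (2 + 2 * m))
    ≡⟨ #words-suc-U (contributes n) (λ _ → refl) (1 + 2 * m) ⟩
  #[ contributes n ∘ (U ∷_) ] (words (1 + 2 * m))
    ≡⟨ #-cong (contributes-U n) (words (1 + 2 * m)) ⟩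
  afterUp 0 n (1 + 2 * m)
    ∎
  where open ≡-Reasoning

count-recurrence : ∀ n m → count (2 + n) (2 + m) ≡ count (1 + n) (1 + m) + count n (1 + m)
count-recurrence n m = begin
  count (2 + n) (2 + m)
    ≡⟨ count-suc (2 + n) (1 + m) ⟩
  afterUp 0 (2 + n) (1 + 2 * suc m)
    ≡⟨ cong (afterUp 0 (2 + n) ∘ suc) (*-suc 2 m) ⟩
  afterUp 0 (2 + n) (3 + L)
    ≡⟨ afterUp-suc 0 (2 + n) (2 + L) ⟩
  afterUp 1 (2 + n) (2 + L) + afterPeak 0 (2 + n) (2 + L)
    ≡⟨ cong₂ _+_ (afterUp-shrink 0 (1 + n) (1 + L)) (afterPeak-ground n (1 + L)) ⟩
  afterUp 0 (1 + n) (1 + L) + afterUp 0 n (1 + L)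
    ≡⟨ cong₂ _+_ (count-suc (1 + n) m) (count-suc n m) ⟨
  count (1 + n) (1 + m) + count n (1 + m)
    ∎
  where
  open ≡-Reasoning
  L : ℕ
  L = 2 * m

count-light : ∀ {n} m → n < 2 → count n (suc m) ≡ 0
count-light {n} m n<2 = trans (count-suc n m) (afterUp-light (1 + 2 * m) n<2)

count-vanishes : ∀ n m → n < m → count n m ≡ 0
count-vanishes zero          (suc m)       _               = count-light m (s≤s z≤n)
count-vanishes (suc zero)    (suc m)       _               = count-light m (s≤s (s≤s z≤n))
count-vanishes (suc (suc n)) (suc (suc m)) (s≤s (s≤s n<m)) =
  trans (count-recurrence n m)
        (cong₂ _+_ (count-vanishes (suc n) (suc m) (s≤s n<m))
                   (count-vanishes n (suc m) (m<n⇒m<1+n n<m)))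

coeffA-as-sum : ∀ n → coeffA n ≡ sum (applyUpTo (count n ∘ suc) n)
coeffA-as-sum n = cong sum (map-applyUpTo suc (count n) n)

coeffA-as-sum-suc : ∀ n → coeffA n ≡ sum (applyUpTo (count n ∘ suc) (1 + n))
coeffA-as-sum-suc n = begin
  coeffA n
    ≡⟨ coeffA-as-sum n ⟩
  sum (applyUpTo (count n ∘ suc) n)
    ≡⟨ +-identityʳ _ ⟨
  sum (applyUpTo (count n ∘ suc) n) + 0
    ≡⟨ cong (λ x → sum (applyUpTo (count n ∘ suc) n) + x) (count-vanishes n (1 + n) (n<1+n n)) ⟨
  sum (applyUpTo (count n ∘ suc) n) + count n (1 + n)
    ≡⟨ sum-applyUpTo-suc (count n ∘ suc) n ⟨
  sum (applyUpTo (count n ∘ suc) (1 + n))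
    ∎
  where open ≡-Reasoning

coeffA-recurrence : ∀ n → coeffA (2 + n) ≡ count (2 + n) 1 + (coeffA (1 + n) + coeffA n)
coeffA-recurrence n = begin
  coeffA (2 + n)
    ≡⟨ coeffA-as-sum (2 + n) ⟩
  count (2 + n) 1 + sum (applyUpTo (λ m → count (2 + n) (2 + m)) (1 + n))
    ≡⟨ cong (λ x → count (2 + n) 1 + x)
            (sum-applyUpTo-+ (count (1 + n) ∘ suc) (count n ∘ suc) (count-recurrence n) (1 + n)) ⟩
  count (2 + n) 1 + (sum (applyUpTo (count (1 + n) ∘ suc) (1 + n))
                     + sum (applyUpTo (count n ∘ suc) (1 + n)))
    ≡⟨ cong (λ x → count (2 + n) 1 + x) (cong₂ _+_ (coeffA-as-sum (1 + n)) (coeffA-as-sum-suc n)) ⟨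
  count (2 + n) 1 + (coeffA (1 + n) + coeffA n)
    ∎
  where open ≡-Reasoning

coeffA-fib : ∀ n → coeffA n ≡ fib (n ∸ 1)
coeffA-fib 0 = refl
coeffA-fib 1 = refl
coeffA-fib 2 = refl
coeffA-fib (suc (suc (suc n))) =
  trans (coeffA-recurrence (suc n)) (cong₂ _+_ (coeffA-fib (suc (suc n))) (coeffA-fib (suc n)))

conv-denom : ∀ (a : ℕ → ℤ) n → conv denom a (2 + n) ≡ a (2 + n) - (a (1 + n) +ℤ a n)
conv-denom a n = begin
  conv denom a (2 + n)
    ≡⟨ cong (λ t → + 1 *ℤ a (2 + n) +ℤ (-1ℤ *ℤ a (1 + n) +ℤ (-1ℤ *ℤ a n +ℤ t)))
            higher-terms ⟩
  + 1 *ℤ a (2 + n) +ℤ (-1ℤ *ℤ a (1 + n) +ℤ (-1ℤ *ℤ a n +ℤ + 0))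
    ≡⟨ normalise (a (2 + n)) (a (1 + n)) (a n) ⟩
  a (2 + n) - (a (1 + n) +ℤ a n)
    ∎
  where
  open ≡-Reasoning
  higher-terms : sumℤ (map (λ i → denom i *ℤ a (2 + n ∸ i)) (applyUpTo (λ i → 3 + i) n)) ≡ + 0
  higher-terms = trans (cong sumℤ (map-applyUpTo (λ i → 3 + i) _ n))
                       (sumℤ-applyUpTo-zero (λ _ → refl) n)
  normalise : ∀ x y z → + 1 *ℤ x +ℤ (-1ℤ *ℤ y +ℤ (-1ℤ *ℤ z +ℤ + 0)) ≡ x - (y +ℤ z)
  normalise = solve-∀

conv-coeffA : ∀ n → conv denom (λ k → + coeffA k) n ≡ numer n
conv-coeffA 0 = refl
conv-coeffA 1 = refl
conv-coeffA 2 = refl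
conv-coeffA (suc (suc (suc n))) = begin
  conv denom (λ k → + coeffA k) (3 + n)
    ≡⟨ conv-denom (λ k → + coeffA k) (1 + n) ⟩
  + coeffA (3 + n) - (+ coeffA (2 + n) +ℤ + coeffA (1 + n))
    ≡⟨ cong₂ (λ x y → + x - y) (coeffA-fib (3 + n))
             (cong₂ (λ y z → + y +ℤ + z) (coeffA-fib (2 + n)) (coeffA-fib (1 + n))) ⟩
  + (F₁ + F₀) - (+ F₁ +ℤ + F₀)
    ≡⟨ cong (λ x → x - (+ F₁ +ℤ + F₀)) (ℤ.pos-+ F₁ F₀) ⟩
  (+ F₁ +ℤ + F₀) - (+ F₁ +ℤ + F₀)
    ≡⟨ ℤ.+-inverseʳ (+ F₁ +ℤ + F₀) ⟩
  + 0
    ∎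
  where
  open ≡-Reasoning
  F₁ F₀ : ℕ
  F₁ = fib (1 + n)
  F₀ = fib n

corollary3p3 :
    ((n m : ℕ) → n < m → count n m ≡ 0)
    × ((n : ℕ) → conv denom (λ k → + coeffA k) n ≡ numer n)
    × ((n : ℕ) → 2 ≤ n → coeffA n ≡ fib (n ∸ 1))
corollary3p3 = count-vanishes , conv-coeffA , λ n _ → coeffA-fib n
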